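{- Let $M,M'$ be maps such that there exist epimorphisms $M\twoheadrightarrow M'$ and $M'\twoheadrightarrow M$ (respectively, monomorphisms $M\rightarrowtail M'$ and $M'\rightarrowtail M$). Then $M$ and $M'$ are isomorphic.
   Context: Maps. A map $M$ is a tuple $(C,\alpha_0,\alpha_1,\alpha_2)$, where $C$ is a finite set (of crosses) and $\alpha_0,\alpha_1,\alpha_2$ are fixed-point-free involutions of $C$ with $\alpha_0\alpha_2=\alpha_2\alpha_0$, together with a finite number (possibly zero) of isolated vertices. Vertex permutation $\tau=\alpha_1\alpha_2$, face permutation $\phi=\alpha_1\alpha_0$. Vertices: orbits of $\langle\alpha_1,\alpha_2\rangle$ on $C$ plus isolated vertices; edges: orbits of $\langle\alpha_0,\alpha_2\rangle$; faces: orbits of $\langle\alpha_0,\alpha_1\rangle$ plus one face per isolated vertex; connected components: orbits of $\langle\alpha_0,\alpha_1,\alpha_2\rangle$ plus one per isolated vertex. A cross is incident with the vertex/face containing it; two crosses are coincident with a face if they lie in the same cycle of $\phi$; the degree of a face is the number of crosses in one of its $\phi$-cycles. For connected $M$ with an edge, $\mathbf o(M)$ is the number of orbits of $\langle\alpha_0\alpha_2,\alpha_1\alpha_2\rangle$ on $C$; an edgeless connected map has $\mathbf o=2$; in general $\mathbf o$ is the minimum over components. With $\mathbf v,\mathbf e,\mathbf f,\mathbf k$ the numbers of vertices, edges, faces, components: $\mathbf{eg}=2\mathbf k-(\mathbf v-\mathbf e+\mathbf f)$, $\mathbf g=\mathbf{eg}/\mathbf o$, signed genus $\mathbf{sg}=(2\mathbf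 o-3)\mathbf g$. Maps are isomorphic if they have the same number of isolated vertices and there is a bijection of crosses commuting with each $\alpha_i$. Deletion and submaps: $M\backslash e$ removes the four crosses of edge $e$, restricts $\alpha_0,\alpha_2$, and chooses $\alpha_1$ so that the new vertex permutation cycles are those of $\tau$ with the crosses of $e$ removed (a vertex all of whose crosses lie in $e$ becomes isolated). Deleting a vertex deletes its incident edges then removes it. A submap is obtained by deleting some edges then some vertices. Vertex gluing: for distinct crosses $a,b$ let $M^{(a\,b)}=(C,\alpha_0,(a\;b)\alpha_1(a\;b),\alpha_2)$. If $a,b$ are incident with distinct vertices and either are coincident with a common face or lie in different components, passing to $M^{(a\,b)}$ is a vertex gluing; deleting an isolated vertex when gluing it to another vertex is also a vertex gluing. Duplicate edges: two distinct edges incident with a common face of degree two; gluing them replaces $M$ by (a map isomorphic to) $M\backslash f$ for one of them $f$. For maps $M,N$ of the same signed genus, an epimorphism $M\twoheadrightarrow N$ is an isomorphism from $N$ to a map obtained from $M$ by a finite (possibly empty) sequence of vertex gluings and duplicate edge gluings. A monomorphism $M\rightarrowtail N$ is an isomorphism from $M$ to a submap of $N$. -}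

module Defs where

open import Data.Nat using (ℕ; zero; suc; _+_; _*_; _<_; _≤_; _⊓_)
open import Data.Integer as ℤ using (ℤ; +_; _-_)
open import Data.Integer.DivMod using (_/ℕ_)
open import Data.Fin using (Fin; toℕ)
open import Data.Fin.Properties using (_≟_; _<?_)
open import Data.Bool using (Bool; true; false; _∧_; _∨_; not; if_then_else_)
open import Data.List using (List; []; _∷_; _++_; map; allFin; foldr)
open import Data.Bool.ListAction using (any; all)
open import Data.Nat.ListAction using (sum)
open import Data.Product using (Σ; ∃; _×_; _,_)
open import Data.Sum using (_⊎_)
open import Relation.Nullary using (¬_; ⌊_⌋)
open import Relation.Binary.PropositionalEquality using (_≡_; _≢_)
open import Relation.Binary.Construct.Closure.ReflexiveTransitive using (Star)
open import Function.Bundles using (_↔_; Inverse)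

-- Maps.  Crosses are Fin n; isolated vertices are just counted.

record MapOn (n : ℕ) : Set where
  field
    iso : ℕ
    α₀ α₁ α₂ : Fin n → Fin n
    α₀-invol : ∀ x → α₀ (α₀ x) ≡ x
    α₁-invol : ∀ x → α₁ (α₁ x) ≡ x
    α₂-invol : ∀ x → α₂ (α₂ x) ≡ x
    α₀-fpf : ∀ x → α₀ x ≢ x
    α₁-fpf : ∀ x → α₁ x ≢ x
    α₂-fpf : ∀ x → α₂ x ≢ x
    α₀α₂-comm : ∀ x → α₀ (α₂ x) ≡ α₂ (α₀ x)

  τ : Fin n → Fin n
  τ x = α₁ (α₂ x)
  φ : Fin n → Fin n
  φ x = α₁ (α₀ x)

open MapOn public

Map : Set
Map = Σ ℕ MapOn

iter : ∀ {A : Set} → (A → A) → ℕ → A → A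
iter f zero x = x
iter f (suc k) x = f (iter f k x)

anyFin : ∀ {n} → (Fin n → Bool) → Bool
anyFin {n} p = any p (allFin n)

allFin? : ∀ {n} → (Fin n → Bool) → Bool
allFin? {n} p = all p (allFin n)

countFin : ∀ {n} → (Fin n → Bool) → ℕ
countFin {n} p = sum (map (λ x → if p x then 1 else 0) (allFin n))

reachIn : ∀ {n} → List (Fin n → Fin n) → ℕ → Fin n → Fin n → Bool
reachIn gs zero x y = ⌊ y ≟ x ⌋
reachIn gs (suc k) x y =
  reachIn gs k x y ∨ any (λ g → anyFin (λ z → reachIn gs k x z ∧ ⌊ g z ≟ y ⌋)) gs

-- y lies in the orbit of x under the group generated by the permutations gs
-- (on a set of n elements, n rounds of forward closure give the whole orbit).
sameOrbitB : ∀ {n} → List (Fin n → Fin n) → Fin n → Fin n → Bool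
sameOrbitB {n} gs x y = reachIn gs n x y

SameOrbit : ∀ {n} → List (Fin n → Fin n) → Fin n → Fin n → Set
SameOrbit gs x y = sameOrbitB gs x y ≡ true

isRep : ∀ {n} → List (Fin n → Fin n) → Fin n → Bool
isRep gs x = not (anyFin (λ y → sameOrbitB gs x y ∧ ⌊ y <? x ⌋))

numOrbits : ∀ {n} → List (Fin n → Fin n) → ℕ
numOrbits gs = countFin (isRep gs)

module _ {n : ℕ} (M : MapOn n) where

  vertexGens edgeGens faceGens compGens orientGens : List (Fin n → Fin n)
  vertexGens = α₁ M ∷ α₂ M ∷ []
  edgeGens = α₀ M ∷ α₂ M ∷ []
  faceGens = α₀ M ∷ α₁ M ∷ []
  compGens = α₀ M ∷ α₁ M ∷ α₂ M ∷ []
  orientGens = (λ x → α₀ M (α₂ M x)) ∷ (λ x → α₁ M (α₂ M x)) ∷ []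

  SameVertex SameEdge SameFace SameComp : Fin n → Fin n → Set
  SameVertex = SameOrbit vertexGens
  SameEdge = SameOrbit edgeGens
  SameFace = SameOrbit faceGens
  SameComp = SameOrbit compGens

  Coincident : Fin n → Fin n → Set
  Coincident x y = Σ ℕ λ k → iter (φ M) k x ≡ y

  FaceDegTwo : Fin n → Set
  FaceDegTwo x = (φ M (φ M x) ≡ x) × (φ M x ≢ x)

  #v #e #f #k : ℕ
  #v = numOrbits vertexGens + iso M
  #e = numOrbits edgeGens
  #f = numOrbits faceGens + iso M
  #k = numOrbits compGens + iso M

  compOrient : Fin n → ℕ
  compOrient x = countFin (λ y → sameOrbitB compGens x y ∧ isRep orientGens y)

  -- minimum of a list; empty list (empty map) gets the harmless value 2
  minList : List ℕ → ℕ
  minList [] = 2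
  minList (x ∷ xs) = foldr _⊓_ x xs

  -- o(M): minimum over components; an edgeless (isolated-vertex) component has o = 2
  #o : ℕ
  #o = minList ((if ⌊ 0 Data.Nat.<? iso M ⌋ then 2 ∷ [] else []) ++ map compOrient (allFin n))

  eg : ℤ
  eg = + (2 * #k) - ((+ #v - + #e) ℤ.+ + #f)

  -- integer division by o (o is always 1 or 2; the zero case never occurs)
  divBy : ℤ → ℕ → ℤ
  divBy z zero = + 0
  divBy z (suc d) = z /ℕ suc d

  genus : ℤ
  genus = divBy eg #o

  signedGenus : ℤ
  signedGenus = (+ (2 * #o) - + 3) ℤ.* genus

  verticesInsideEdge : Fin n → ℕ
  verticesInsideEdge c =
    countFin (λ x → isRep vertexGens x ∧
      allFin? (λ y → not (sameOrbitB vertexGens x y) ∨ sameOrbitB edgeGens c y))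

sg : Map → ℤ
sg (n , M) = signedGenus M

record IsoOn {n m : ℕ} (M : MapOn n) (N : MapOn m) : Set where
  field
    iso-eq : iso M ≡ iso N
    bij : Fin n ↔ Fin m
    comm₀ : ∀ x → Inverse.to bij (α₀ M x) ≡ α₀ N (Inverse.to bij x)
    comm₁ : ∀ x → Inverse.to bij (α₁ M x) ≡ α₁ N (Inverse.to bij x)
    comm₂ : ∀ x → Inverse.to bij (α₂ M x) ≡ α₂ N (Inverse.to bij x)

_≅_ : Map → Map → Set
(n , M) ≅ (m , N) = IsoOn M N

-- Edge deletion: N is (an isomorphic copy of) M \ e, e the edge of cross c.
-- ι embeds the crosses of N as the crosses of M outside e.

record Deletion {n m : ℕ} (M : MapOn n) (c : Fin n) (N : MapOn m) : Set where
  field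
    ι : Fin m → Fin n
    ι-inj : ∀ y z → ι y ≡ ι z → y ≡ z
    ι-avoid : ∀ y → ¬ SameEdge M c (ι y)
    ι-onto : ∀ x → ¬ SameEdge M c x → ∃ λ y → ι y ≡ x
    ι-α₀ : ∀ y → ι (α₀ N y) ≡ α₀ M (ι y)
    ι-α₂ : ∀ y → ι (α₂ N y) ≡ α₂ M (ι y)
    -- new vertex permutation: the cycles of τ with the crosses of e removed
    ι-τ : ∀ y → Σ ℕ λ k → (ι (τ N y) ≡ iter (τ M) (suc k) (ι y))
                 × (∀ j → j < k → SameEdge M c (iter (τ M) (suc j) (ι y)))
    -- vertices all of whose crosses lie in e become isolated
    iso-eq : iso N ≡ iso M + verticesInsideEdge M c

DelStep : Map → Map → Set
DelStep (n , M) (m , N) = Σ (Fin n) λ c → Deletion M c N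

data RemoveIsolated : Map → Map → Set where
  remove : ∀ {n} (Q S : MapOn n) →
    (∀ x → α₀ S x ≡ α₀ Q x) → (∀ x → α₁ S x ≡ α₁ Q x) → (∀ x → α₂ S x ≡ α₂ Q x) →
    iso S ≤ iso Q → RemoveIsolated (n , Q) (n , S)

Submap : Map → Map → Set
Submap N S = Σ Map λ Q → Star DelStep N Q × RemoveIsolated Q S

Mono : Map → Map → Set
Mono M N = Σ Map λ S → Submap N S × (M ≅ S)

swapAt : ∀ {n} → Fin n → Fin n → Fin n → Fin n
swapAt a b x = if ⌊ x ≟ a ⌋ then b else (if ⌊ x ≟ b ⌋ then a else x)

data GlueStep : Map → Map → Set where
  vglue : ∀ {n} (M N : MapOn n) (a b : Fin n) →
    a ≢ b →
    ¬ SameVertex M a b →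
    (Coincident M a b ⊎ ¬ SameComp M a b) →
    iso N ≡ iso M →
    (∀ x → α₀ N x ≡ α₀ M x) →
    (∀ x → α₁ N x ≡ swapAt a b (α₁ M (swapAt a b x))) →
    (∀ x → α₂ N x ≡ α₂ M x) →
    GlueStep (n , M) (n , N)
  -- gluing an isolated vertex to another vertex (deleting it)
  isoglue : ∀ {n} (M N : MapOn n) →
    iso M ≡ suc (iso N) →
    (0 < n ⊎ 0 < iso N) →
    (∀ x → α₀ N x ≡ α₀ M x) → (∀ x → α₁ N x ≡ α₁ M x) → (∀ x → α₂ N x ≡ α₂ M x) →
    GlueStep (n , M) (n , N)
  dupglue : ∀ {n m} (M : MapOn n) (N : MapOn m) (e f : Fin n) →
    ¬ SameEdge M e f →
    (Σ (Fin n) λ x → Σ (Fin n) λ y →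
       SameEdge M e x × SameEdge M f y × SameFace M x y × FaceDegTwo M x) →
    Deletion M f N →
    GlueStep (n , M) (m , N)

Epi : Map → Map → Set
Epi M N = (sg M ≡ sg N) × (Σ Map λ S → Star GlueStep M S × (N ≅ S))

-- Gluings and deletions strictly decrease the key (number of crosses, number of
-- isolated vertices, minus the number of ordered pairs of crosses on a common vertex)
-- in the lexicographic order: a vertex gluing merges two vertices without splitting
-- any, removing isolated vertices or edges loses vertices or crosses.  Isomorphisms
-- preserve the key, so a morphism is an isomorphism or strictly changes the key, and
-- morphisms in both directions leave no room for a strict change.

module Submission where

open import Defs
open import Data.Bool using (Bool; true; false; _∧_; _∨_; if_then_else_)
open import Data.Bool.ListAction using (any)
open import Data.Bool.Properties using (T-≡; ∨-zeroʳ; ¬-not)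
open import Data.Empty using (⊥-elim)
open import Data.Fin as Fin using (Fin; toℕ; punchOut)
open import Data.Fin.Permutation using (↔⇒≡)
open import Data.Fin.Properties using (_≟_; pigeonhole; injective⇒≤; punchOut-injective)
open import Data.List using (List; allFin)
open import Data.List.Membership.Propositional using (_∈_; find; lose)
open import Data.List.Membership.Propositional.Properties using (∈-allFin)
open import Data.List.Relation.Unary.Any using (Any; here; there)
open import Data.List.Relation.Unary.Any.Properties using (any⁺; any⁻)
open import Data.Nat using (ℕ; zero; suc; _+_; _∸_; _<_; _≤_; _>_; _≤′_; ≤′-refl; ≤′-step; z≤n; s≤s; s≤s⁻¹)
open import Data.Nat.Properties hiding (_≟_)
import Data.Nat.Properties as ℕₚ
open import Algebra.Properties.CommutativeMonoid.Sum +-0-commutativeMonoid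
  using (sum; sum-syntax; sum-permute; sum-cong-≗)
open import Data.Product using (∃; _×_; _,_)
open import Data.Product.Relation.Binary.Lex.Strict using (×-Lex; ×-transitive; ×-irreflexive)
open import Data.Product.Relation.Binary.Pointwise.NonDependent using (Pointwise)
open import Data.Sum using (_⊎_; inj₁; inj₂)
open import Function using (_∘_; flip; Equivalence)
open import Function.Bundles using (Inverse)
open import Function.Properties.Inverse using (↔-refl; ↔-sym; ↔-trans)
open import Relation.Binary using (Rel; Transitive)
open import Relation.Binary.Construct.Closure.ReflexiveTransitive using (Star; ε; _◅_; _◅◅_; gmap; map; concat; reverse)
open import Relation.Binary.PropositionalEquality
open import Relation.Nullary using (¬_; yes; no; ⌊_⌋)
open import Relation.Nullary.Decidable using (toWitness; fromWitness)

∨-true⁻ : ∀ b {c} → b ∨ c ≡ true → b ≡ true ⊎ c ≡ true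
∨-true⁻ true  _ = inj₁ refl
∨-true⁻ false e = inj₂ e

∧-true⁻ : ∀ b {c} → b ∧ c ≡ true → b ≡ true × c ≡ true
∧-true⁻ true e = refl , e

∨-trueʳ : ∀ b {c} → c ≡ true → b ∨ c ≡ true
∨-trueʳ b e = trans (cong (b ∨_) e) (∨-zeroʳ b)

Bool-ext : ∀ {b c} → (b ≡ true → c ≡ true) → (c ≡ true → b ≡ true) → b ≡ c
Bool-ext {true}  f g = sym (f refl)
Bool-ext {false} {false} f g = refl
Bool-ext {false} {true}  f g = g refl

≟-true⁻ : ∀ {n} {x y : Fin n} → ⌊ x ≟ y ⌋ ≡ true → x ≡ y
≟-true⁻ e = toWitness (Equivalence.from T-≡ e)

≟-true⁺ : ∀ {n} {x y : Fin n} → x ≡ y → ⌊ x ≟ y ⌋ ≡ true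
≟-true⁺ e = Equivalence.to T-≡ (fromWitness e)

any-true⁻ : ∀ {A : Set} (p : A → Bool) xs → any p xs ≡ true → ∃ λ x → x ∈ xs × p x ≡ true
any-true⁻ p xs e with find (any⁻ p xs (Equivalence.from T-≡ e))
... | x , x∈xs , px = x , x∈xs , Equivalence.to T-≡ px

any-true⁺ : ∀ {A : Set} (p : A → Bool) {x xs} → x ∈ xs → p x ≡ true → any p xs ≡ true
any-true⁺ p x∈xs e = Equivalence.to T-≡ (any⁺ p (lose x∈xs (Equivalence.from T-≡ e)))

Step : ∀ {n} → List (Fin n → Fin n) → Rel (Fin n) _
Step gs x y = Any (λ g → g x ≡ y) gs

Path : ∀ {n} → List (Fin n → Fin n) → Rel (Fin n) _
Path gs = Star (Step gs)

∑-mono-≤ : ∀ {n} {f g : Fin n → ℕ} → (∀ i → f i ≤ g i) → sum f ≤ sum g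
∑-mono-≤ {zero}  f≤g = z≤n
∑-mono-≤ {suc n} f≤g = +-mono-≤ (f≤g Fin.zero) (∑-mono-≤ (f≤g ∘ Fin.suc))

∑-mono-< : ∀ {n} {f g : Fin n → ℕ} → (∀ i → f i ≤ g i) → ∀ i → f i < g i → sum f < sum g
∑-mono-< f≤g Fin.zero    lt = +-mono-<-≤ lt (∑-mono-≤ (f≤g ∘ Fin.suc))
∑-mono-< f≤g (Fin.suc i) lt = +-mono-≤-< (f≤g Fin.zero) (∑-mono-< (f≤g ∘ Fin.suc) i lt)

indicator : Bool → ℕ
indicator b = if b then 1 else 0

indicator-≤ : ∀ b → indicator b ≤ 1
indicator-≤ true  = ≤-refl
indicator-≤ false = z≤n

indicator-mono : ∀ {b c} → (b ≡ true → c ≡ true) → indicator b ≤ indicator c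
indicator-mono {false} _ = z≤n
indicator-mono {true}  h rewrite h refl = ≤-refl

count : ∀ {n} → (Fin n → Bool) → ℕ
count {n} p = ∑[ i < n ] indicator (p i)

count-≤ : ∀ {n} (p : Fin n → Bool) → count p ≤ n
count-≤ {zero}  p = z≤n
count-≤ {suc n} p = +-mono-≤ (indicator-≤ (p Fin.zero)) (count-≤ (p ∘ Fin.suc))

count-mono-≤ : ∀ {n} {p q : Fin n → Bool} → (∀ i → p i ≡ true → q i ≡ true) → count p ≤ count q
count-mono-≤ p⊆q = ∑-mono-≤ λ i → indicator-mono (p⊆q i)

count-mono-< : ∀ {n} {p q : Fin n → Bool} → (∀ i → p i ≡ true → q i ≡ true) →
  ∀ i → p i ≡ false → q i ≡ true → count p < count q
count-mono-< p⊆q i pi qi =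
  ∑-mono-< (λ j → indicator-mono (p⊆q j)) i (subst₂ (λ b c → indicator b < indicator c) (sym pi) (sym qi) ≤-refl)

count-≤⇒⊇ : ∀ {n} {p q : Fin n → Bool} → (∀ i → p i ≡ true → q i ≡ true) →
  count q ≤ count p → ∀ i → q i ≡ true → p i ≡ true
count-≤⇒⊇ {p = p} p⊆q q≤p i qi with p i in pi
... | true  = refl
... | false = ⊥-elim (<⇒≱ (count-mono-< p⊆q i pi qi) q≤p)

count-pos : ∀ {n} (p : Fin n → Bool) i → p i ≡ true → 0 < count p
count-pos p Fin.zero    e rewrite e = s≤s z≤n
count-pos p (Fin.suc i) e = <-≤-trans (count-pos (p ∘ Fin.suc) i e) (m≤n+m _ (indicator (p Fin.zero)))

plateau : (c : ℕ → ℕ) → (∀ k → c k ≤ c (suc k)) →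
  ∀ m → c m < m + c 0 → ∃ λ k → k < m × c (suc k) ≡ c k
plateau c mono zero    lt = ⊥-elim (<-irrefl refl lt)
plateau c mono (suc m) lt with c (suc m) ℕₚ.≟ c m
... | yes e = m , n<1+n m , e
... | no ne with plateau c mono m (<-≤-trans (≤∧≢⇒< (mono m) (ne ∘ sym)) (s≤s⁻¹ lt))
...   | k , k<m , e = k , m<n⇒m<1+n k<m , e

module Reachability {n} (gs : List (Fin n → Fin n)) (x : Fin n) where

  Reached : ℕ → Fin n → Set
  Reached k y = reachIn gs k x y ≡ true

  reached-start : Reached 0 x
  reached-start = ≟-true⁺ refl

  reached-suc : ∀ k {y} → Reached k y → Reached (suc k) y
  reached-suc k e rewrite e = refl

  reached-mono : ∀ {k m y} → k ≤ m → Reached k y → Reached m y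
  reached-mono k≤m = go (≤⇒≤′ k≤m)
    where
    go : ∀ {k m y} → k ≤′ m → Reached k y → Reached m y
    go ≤′-refl        e = e
    go {m = suc m} (≤′-step k≤′m) e = reached-suc m (go k≤′m e)

  reached-step : ∀ k {z y} → Reached k z → Step gs z y → Reached (suc k) y
  reached-step k {z} {y} e s with find s
  ... | g , g∈gs , gz≡y = ∨-trueʳ (reachIn gs k x y)
        (any-true⁺ _ g∈gs (any-true⁺ _ (∈-allFin z) (cong₂ _∧_ e (≟-true⁺ gz≡y))))

  reached-suc⁻ : ∀ k {y} → Reached (suc k) y → Reached k y ⊎ ∃ λ z → Reached k z × Step gs z y
  reached-suc⁻ k {y} e with ∨-true⁻ (reachIn gs k x y) e
  ... | inj₁ r = inj₁ r
  ... | inj₂ r with any-true⁻ _ gs r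
  ...   | g , g∈gs , r′ with any-true⁻ _ (allFin n) r′
  ...     | z , _ , r″ with ∧-true⁻ (reachIn gs k x z) r″
  ...       | rz , gz≡y = inj₂ (z , rz , lose g∈gs (≟-true⁻ gz≡y))

  reached⇒path : ∀ k {y} → Reached k y → Path gs x y
  reached⇒path zero    e = subst (Path gs x) (sym (≟-true⁻ e)) ε
  reached⇒path (suc k) e with reached-suc⁻ k e
  ... | inj₁ r           = reached⇒path k r
  ... | inj₂ (z , r , s) = reached⇒path k r ◅◅ (s ◅ ε)

  reachedCount : ℕ → ℕ
  reachedCount k = count (reachIn gs k x)

  reachedCount-n< : reachedCount n < n + reachedCount 0
  reachedCount-n< = ≤-<-trans (count-≤ _) (m<m+n n (count-pos _ x reached-start))

  -- There are only n crosses to reach, so some closure round before the n-th adds nothing.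
  stall : ∃ λ k → k < n × ∀ {y} → Reached (suc k) y → Reached k y
  stall with plateau reachedCount (λ k → count-mono-≤ (λ y → reached-suc k {y})) n reachedCount-n<
  ... | k , k<n , eq = k , k<n , count-≤⇒⊇ (λ y → reached-suc k {y}) (≤-reflexive eq) _

  reached-closed : ∀ k → (∀ {y} → Reached (suc k) y → Reached k y) →
    ∀ {z y} → Reached k z → Path gs z y → Reached k y
  reached-closed k st r ε       = r
  reached-closed k st r (s ◅ p) = reached-closed k st (st (reached-step k r s)) p

path⇒sameOrbit : ∀ {n} (gs : List (Fin n → Fin n)) {x y} → Path gs x y → SameOrbit gs x y
path⇒sameOrbit gs {x} p =
  let k , k<n , st = stall
  in reached-mono (<⇒≤ k<n) (reached-closed k st (reached-mono (z≤n {k}) reached-start) p)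
  where open Reachability gs x

sameOrbit⇒path : ∀ {n} (gs : List (Fin n → Fin n)) {x y} → SameOrbit gs x y → Path gs x y
sameOrbit⇒path {n} gs {x} = Reachability.reached⇒path gs x n

involution-injective : ∀ {A : Set} {f : A → A} → (∀ x → f (f x) ≡ x) → ∀ {x y} → f x ≡ f y → x ≡ y
involution-injective {f = f} invol {x} {y} e = trans (sym (invol x)) (trans (cong f e) (invol y))

iter-suc′ : ∀ {A : Set} (f : A → A) k x → iter f (suc k) x ≡ iter f k (f x)
iter-suc′ f zero    x = refl
iter-suc′ f (suc k) x = cong f (iter-suc′ f k x)

iter-+ : ∀ {A : Set} (f : A → A) j k x → iter f (j + k) x ≡ iter f j (iter f k x)
iter-+ f zero    k x = refl
iter-+ f (suc j) k x = cong f (iter-+ f j k x)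

iter-injective : ∀ {A : Set} {f : A → A} → (∀ {x y} → f x ≡ f y → x ≡ y) →
  ∀ k {x y} → iter f k x ≡ iter f k y → x ≡ y
iter-injective f-inj zero    e = e
iter-injective f-inj (suc k) e = iter-injective f-inj k (f-inj e)

iter-periodic : ∀ {n} {f : Fin n → Fin n} → (∀ {x y} → f x ≡ f y → x ≡ y) →
  ∀ x → ∃ λ k → iter f (suc k) x ≡ x
iter-periodic {n} {f} f-inj x with pigeonhole (n<1+n n) (λ i → iter f (toℕ i) x)
... | i , j , i<j , e = d , sym (iter-injective f-inj (toℕ i) (trans e fʲx))
  where
  open ≡-Reasoning
  d = toℕ j ∸ suc (toℕ i)
  fʲx : iter f (toℕ j) x ≡ iter f (toℕ i) (iter f (suc d) x)
  fʲx = begin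
    iter f (toℕ j) x               ≡⟨ cong (λ m → iter f m x) (m+[n∸m]≡n i<j) ⟨
    iter f (suc (toℕ i) + d) x     ≡⟨ cong (λ m → iter f m x) (+-suc (toℕ i) d) ⟨
    iter f (toℕ i + suc d) x       ≡⟨ iter-+ f (toℕ i) (suc d) x ⟩
    iter f (toℕ i) (iter f (suc d) x) ∎

module Vertex {n} (M : MapOn n) where

  VStep : Rel (Fin n) _
  VStep = Step (vertexGens M)

  VPath : Rel (Fin n) _
  VPath = Path (vertexGens M)

  α₁-step : ∀ x → VStep x (α₁ M x)
  α₁-step x = here refl

  α₂-step : ∀ x → VStep x (α₂ M x)
  α₂-step x = there (here refl)

  VStep-sym : ∀ {x y} → VStep x y → VStep y x
  VStep-sym (here refl)         = here (α₁-invol M _)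
  VStep-sym (there (here refl)) = there (here (α₂-invol M _))

  SameVertex-sym : ∀ {x y} → SameVertex M x y → SameVertex M y x
  SameVertex-sym s = path⇒sameOrbit _ (reverse VStep-sym (sameOrbit⇒path _ s))

  τ-path : ∀ j x → VPath x (iter (τ M) j x)
  τ-path zero    x = ε
  τ-path (suc j) x = τ-path j x ◅◅ (α₂-step _ ◅ α₁-step _ ◅ ε)

  τ-injective : ∀ {x y} → τ M x ≡ τ M y → x ≡ y
  τ-injective = involution-injective {f = α₂ M} (α₂-invol M) ∘ involution-injective {f = α₁ M} (α₁-invol M)

  α₁-transpose : ∀ {x y} → α₁ M x ≡ y → α₁ M y ≡ x
  α₁-transpose {x} e = trans (cong (α₁ M) (sym e)) (α₁-invol M x)

  -- α₂ ∘ τʲ is conjugate to α₂ or α₁ by a power of τ, hence fixed-point free.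
  α₂-iter-τ-≢ : ∀ j x → α₂ M (iter (τ M) j x) ≢ x
  α₂-iter-τ-≢ zero          x e = α₂-fpf M x e
  α₂-iter-τ-≢ (suc zero)    x e = α₁-fpf M (α₂ M x) (trans (sym (α₂-invol M _)) (cong (α₂ M) e))
  α₂-iter-τ-≢ (suc (suc j)) x e = α₂-iter-τ-≢ j (τ M x) u≡τx
    where
    u = α₂ M (iter (τ M) j (τ M x))
    α₂α₁u≡x : α₂ M (α₁ M u) ≡ x
    α₂α₁u≡x = trans (cong (λ w → α₂ M (τ M w)) (sym (iter-suc′ (τ M) j x))) e
    u≡τx : u ≡ τ M x
    u≡τx = trans (sym (α₁-invol M u)) (cong (α₁ M) (trans (sym (α₂-invol M _)) (cong (α₂ M) α₂α₁u≡x)))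

swapAt-other : ∀ {n} {a b x : Fin n} → x ≢ a → x ≢ b → swapAt a b x ≡ x
swapAt-other {a = a} {b} {x} x≢a x≢b with x ≟ a | x ≟ b
... | yes x≡a | _       = ⊥-elim (x≢a x≡a)
... | no _    | yes x≡b = ⊥-elim (x≢b x≡b)
... | no _    | no _    = refl

swapAt-left : ∀ {n} {a b : Fin n} → swapAt a b a ≡ b
swapAt-left {a = a} with a ≟ a
... | yes _   = refl
... | no a≢a = ⊥-elim (a≢a refl)

swapAt-comm : ∀ {n} {a b : Fin n} → a ≢ b → ∀ x → swapAt a b x ≡ swapAt b a x
swapAt-comm {a = a} {b} a≢b x with x ≟ a | x ≟ b
... | yes refl | yes refl = ⊥-elim (a≢b refl)
... | yes refl | no _     = refl
... | no _     | yes refl = refl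
... | no _     | no _     = refl

vertexPairs : ∀ {n} → MapOn n → ℕ
vertexPairs {n} M = ∑[ x < n ] count (sameOrbitB (vertexGens M) x)

module VertexGluing {n} (M N : MapOn n) (a b : Fin n) (a≁b : ¬ SameVertex M a b)
  (α₁-glued : ∀ x → α₁ N x ≡ swapAt a b (α₁ M (swapAt a b x)))
  (α₂-glued : ∀ x → α₂ N x ≡ α₂ M x) where

  open Vertex M

  NStep : Rel (Fin n) _
  NStep = Step (vertexGens N)

  NPath : Rel (Fin n) _
  NPath = Path (vertexGens N)

  VPath-≢b : ∀ {z} → VPath a z → z ≢ b
  VPath-≢b p refl = a≁b (path⇒sameOrbit _ p)

  α₁-unglued : ∀ {w} → w ≢ a → w ≢ b → α₁ M w ≢ a → α₁ M w ≢ b → α₁ N w ≡ α₁ M w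
  α₁-unglued w≢a w≢b α₁w≢a α₁w≢b =
    trans (α₁-glued _) (trans (cong (swapAt a b ∘ α₁ M) (swapAt-other w≢a w≢b)) (swapAt-other α₁w≢a α₁w≢b))

  α₂-Nstep : ∀ w → NStep w (α₂ M w)
  α₂-Nstep w = there (here (α₂-glued w))

  -- Going backwards round the old vertex of a, N agrees with M until α₁ M a is reached.
  walk : ∀ j → NPath a (α₁ M a) ⊎ NPath a (iter (τ M) j a)
  walk zero = inj₂ ε
  walk (suc j) with walk j
  ... | inj₁ p = inj₁ p
  ... | inj₂ p with α₂ M (iter (τ M) j a) ≟ α₁ M a
  ...   | yes e = inj₁ (subst (NPath a) e (p ◅◅ (α₂-Nstep _ ◅ ε)))
  ...   | no ne = inj₂ (p ◅◅ (α₂-Nstep _ ◅ here α₁N≡α₁M ◅ ε))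
    where
    α₁N≡α₁M : α₁ N (α₂ M (iter (τ M) j a)) ≡ τ M (iter (τ M) j a)
    α₁N≡α₁M = α₁-unglued (α₂-iter-τ-≢ j a) (VPath-≢b (τ-path j a ◅◅ (α₂-step _ ◅ ε)))
      (ne ∘ sym ∘ α₁-transpose) (VPath-≢b (τ-path (suc j) a))

  NPath-α₁ : NPath a (α₁ M a)
  NPath-α₁ with iter-periodic τ-injective a
  ... | k , τᵏ⁺¹a≡a with walk k
  ...   | inj₁ p = p
  ...   | inj₂ p = subst (NPath a) (sym (α₁-transpose τᵏ⁺¹a≡a)) (p ◅◅ (α₂-Nstep _ ◅ ε))

module _ {n} (M N : MapOn n) (a b : Fin n) (a≁b : ¬ SameVertex M a b)
  (α₁-glued : ∀ x → α₁ N x ≡ swapAt a b (α₁ M (swapAt a b x)))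
  (α₂-glued : ∀ x → α₂ N x ≡ α₂ M x) where

  open Vertex M
  open VertexGluing M N a b a≁b α₁-glued α₂-glued using (NPath; α₁-unglued; NPath-α₁)

  private
    a≢b : a ≢ b
    a≢b refl = a≁b (path⇒sameOrbit (vertexGens M) {a} ε)

    NPath-α₁b : NPath b (α₁ M b)
    NPath-α₁b = VertexGluing.NPath-α₁ M N b a (a≁b ∘ SameVertex-sym) α₁-glued′ α₂-glued
      where
      α₁-glued′ : ∀ x → α₁ N x ≡ swapAt b a (α₁ M (swapAt b a x))
      α₁-glued′ x = trans (α₁-glued x) (trans (swapAt-comm a≢b (α₁ M (swapAt a b x)))
                                              (cong (swapAt b a ∘ α₁ M) (swapAt-comm a≢b x)))

    NPath-to-α₁ : ∀ {x} → x ≡ a ⊎ x ≡ b → NPath x (α₁ M x)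
    NPath-to-α₁ (inj₁ refl) = NPath-α₁
    NPath-to-α₁ (inj₂ refl) = NPath-α₁b

    NPath-from-α₁ : ∀ {y} → y ≡ a ⊎ y ≡ b → NPath (α₁ M y) y
    NPath-from-α₁ y∈ab = reverse (Vertex.VStep-sym N) (NPath-to-α₁ y∈ab)

    VStep⇒NPath : ∀ {x y} → VStep x y → NPath x y
    VStep⇒NPath (there (here e)) = there (here (trans (α₂-glued _) e)) ◅ ε
    VStep⇒NPath {x} {y} (here e) with x ≟ a | x ≟ b | y ≟ a | y ≟ b
    ... | yes x≡a | _       | _       | _       = subst (NPath x) e (NPath-to-α₁ (inj₁ x≡a))
    ... | no _    | yes x≡b | _       | _       = subst (NPath x) e (NPath-to-α₁ (inj₂ x≡b))
    ... | no _    | no _    | yes y≡a | _       = subst (λ z → NPath z y) (α₁-transpose e) (NPath-from-α₁ (inj₁ y≡a))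
    ... | no _    | no _    | no _    | yes y≡b = subst (λ z → NPath z y) (α₁-transpose e) (NPath-from-α₁ (inj₂ y≡b))
    ... | no x≢a  | no x≢b  | no y≢a  | no y≢b  =
      here (trans (α₁-unglued x≢a x≢b (λ e′ → y≢a (trans (sym e) e′)) (λ e′ → y≢b (trans (sym e) e′))) e) ◅ ε

  vertexGluing-⊆ : ∀ {x y} → SameVertex M x y → SameVertex N x y
  vertexGluing-⊆ s = path⇒sameOrbit _ (concat (map VStep⇒NPath (sameOrbit⇒path _ s)))

  vertexGluing-joins : SameVertex N a b
  vertexGluing-joins = path⇒sameOrbit _ (here α₁Na≡α₁Mb ◅ reverse (Vertex.VStep-sym N) NPath-α₁b)
    where
    α₁Mb≢a : α₁ M b ≢ a
    α₁Mb≢a e = a≁b (SameVertex-sym (path⇒sameOrbit _ (subst (VPath b) e (α₁-step b ◅ ε))))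
    α₁Na≡α₁Mb : α₁ N a ≡ α₁ M b
    α₁Na≡α₁Mb = trans (α₁-glued a)
      (trans (cong (swapAt a b ∘ α₁ M) (swapAt-left {a = a} {b})) (swapAt-other α₁Mb≢a (α₁-fpf M b)))

  vertexGluing-vertexPairs : vertexPairs M < vertexPairs N
  vertexGluing-vertexPairs =
    ∑-mono-< (λ x → count-mono-≤ λ y → vertexGluing-⊆ {x} {y}) a
      (count-mono-< (λ y → vertexGluing-⊆ {a} {y}) b (¬-not a≁b) vertexGluing-joins)

deletion-< : ∀ {n m} {M : MapOn n} {c : Fin n} {N : MapOn m} → Deletion M c N → m < n
deletion-< {suc n} {M = M} {c} D = s≤s (injective⇒≤ ι′-injective)
  where
  open Deletion D
  c≢ι : ∀ y → c ≢ ι y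
  c≢ι y e = ι-avoid y (subst (SameEdge M c) e (path⇒sameOrbit (edgeGens M) {c} ε))
  ι′-injective : ∀ {y z} → punchOut (c≢ι y) ≡ punchOut (c≢ι z) → y ≡ z
  ι′-injective {y} {z} e = ι-inj y z (punchOut-injective (c≢ι y) (c≢ι z) e)

module _ {n m} {M : MapOn n} {N : MapOn m} (I : IsoOn M N) where
  open IsoOn I
  open Inverse bij using (to; from; strictlyInverseˡ; strictlyInverseʳ)

  private
    from-comm : ∀ {f : Fin n → Fin n} {g : Fin m → Fin m} →
      (∀ x → to (f x) ≡ g (to x)) → ∀ u → from (g u) ≡ f (from u)
    from-comm {f} {g} c u = begin
      from (g u)                 ≡⟨ cong (from ∘ g) (strictlyInverseˡ u) ⟨
      from (g (to (from u)))     ≡⟨ cong from (c (from u)) ⟨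
      from (to (f (from u)))     ≡⟨ strictlyInverseʳ _ ⟩
      f (from u)                 ∎
      where open ≡-Reasoning

  ≅-sym : IsoOn N M
  ≅-sym = record
    { iso-eq = sym iso-eq
    ; bij    = ↔-sym bij
    ; comm₀  = from-comm comm₀
    ; comm₁  = from-comm comm₁
    ; comm₂  = from-comm comm₂
    }

  ≅-SameVertex : ∀ {x y} → SameVertex M x y → SameVertex N (to x) (to y)
  ≅-SameVertex s = path⇒sameOrbit _ (gmap to transport (sameOrbit⇒path _ s))
    where
    transport : ∀ {x y} → Step (vertexGens M) x y → Step (vertexGens N) (to x) (to y)
    transport (here refl)         = here (sym (comm₁ _))
    transport (there (here refl)) = there (here (sym (comm₂ _)))

≅-trans : ∀ {n m k} {M : MapOn n} {N : MapOn m} {P : MapOn k} → IsoOn M N → IsoOn N P → IsoOn M P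
≅-trans I J = record
  { iso-eq = trans (iso-eq I) (iso-eq J)
  ; bij    = ↔-trans (bij I) (bij J)
  ; comm₀  = λ x → trans (cong (Inverse.to (bij J)) (comm₀ I x)) (comm₀ J _)
  ; comm₁  = λ x → trans (cong (Inverse.to (bij J)) (comm₁ I x)) (comm₁ J _)
  ; comm₂  = λ x → trans (cong (Inverse.to (bij J)) (comm₂ I x)) (comm₂ J _)
  }
  where open IsoOn

≅-pointwise : ∀ {n} {M N : MapOn n} → iso M ≡ iso N →
  (∀ x → α₀ M x ≡ α₀ N x) → (∀ x → α₁ M x ≡ α₁ N x) → (∀ x → α₂ M x ≡ α₂ N x) → IsoOn M N
≅-pointwise i e₀ e₁ e₂ = record { iso-eq = i ; bij = ↔-refl ; comm₀ = e₀ ; comm₁ = e₁ ; comm₂ = e₂ }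

≅-refl : ∀ {n} {M : MapOn n} → IsoOn M M
≅-refl = ≅-pointwise refl (λ _ → refl) (λ _ → refl) (λ _ → refl)

≅-vertexPairs : ∀ {n m} {M : MapOn n} {N : MapOn m} → IsoOn M N → vertexPairs N ≡ vertexPairs M
≅-vertexPairs {n} {m} {M} {N} I = begin
  vertexPairs N                                                   ≡⟨ sum-permute _ (bij I) ⟩
  ∑[ x < n ] count (sameOrbitB (vertexGens N) (to x))
    ≡⟨ sum-cong-≗ (λ x → sum-permute (λ y → indicator (sameOrbitB (vertexGens N) (to x) y)) (bij I)) ⟩
  ∑[ x < n ] ∑[ y < n ] indicator (sameOrbitB (vertexGens N) (to x) (to y))
    ≡⟨ sum-cong-≗ (λ x → sum-cong-≗ λ y → cong indicator (≅-sameOrbitB x y)) ⟩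
  vertexPairs M                                                   ∎
  where
  open ≡-Reasoning
  open IsoOn
  open Inverse (bij I) using (to; from; strictlyInverseʳ)
  ≅-sameOrbitB : ∀ x y → sameOrbitB (vertexGens N) (to x) (to y) ≡ sameOrbitB (vertexGens M) x y
  ≅-sameOrbitB x y = Bool-ext
    (λ s → subst₂ (SameVertex M) (strictlyInverseʳ x) (strictlyInverseʳ y) (≅-SameVertex (≅-sym I) s))
    (≅-SameVertex I)

Key : Set
Key = ℕ × ℕ × ℕ

key : Map → Key
key (n , M) = n , iso M , vertexPairs M

_<ₖ_ : Rel Key _
_<ₖ_ = ×-Lex _≡_ _<_ (×-Lex _≡_ _<_ _>_)

<ₖ-trans : Transitive _<ₖ_
<ₖ-trans = ×-transitive {_≈₁_ = _≡_} {_<₂_ = ×-Lex _≡_ _<_ _>_} isEquivalence (resp₂ _<_) <-trans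
  (×-transitive {_≈₁_ = _≡_} {_<₂_ = _>_} isEquivalence (resp₂ _<_) <-trans (flip <-trans))

<ₖ-irrefl : ∀ k → ¬ k <ₖ k
<ₖ-irrefl _ = ×-irreflexive {_≈₁_ = _≡_} {_≈₂_ = Pointwise _≡_ _≡_} {_<₂_ = ×-Lex _≡_ _<_ _>_} <-irrefl
  (×-irreflexive {_≈₁_ = _≡_} {_≈₂_ = _≡_} {_<₂_ = _>_} <-irrefl (λ e → <-irrefl (sym e)))
  (refl , refl , refl)

≅-key : ∀ {X Y} → X ≅ Y → key X ≡ key Y
≅-key {n , M} {m , N} I with ↔⇒≡ (IsoOn.bij I)
... | refl = cong (n ,_) (cong₂ _,_ (IsoOn.iso-eq I) (sym (≅-vertexPairs I)))

_≼_ : Map → Map → Set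
X ≼ Y = X ≅ Y ⊎ key X <ₖ key Y

≼-trans : ∀ {X Y Z} → X ≼ Y → Y ≼ Z → X ≼ Z
≼-trans {_ , M} {_ , N} {_ , P} (inj₁ I) (inj₁ J) = inj₁ (≅-trans {M = M} {N} {P} I J)
≼-trans {Z = Z} (inj₁ I) (inj₂ l) = inj₂ (subst (_<ₖ key Z) (sym (≅-key I)) l)
≼-trans {X} (inj₂ l) (inj₁ J) = inj₂ (subst (key X <ₖ_) (≅-key J) l)
≼-trans (inj₂ l) (inj₂ l′) = inj₂ (<ₖ-trans l l′)

≼-antisym : ∀ {X Y} → X ≼ Y → Y ≼ X → X ≅ Y
≼-antisym (inj₁ I) _ = I
≼-antisym {_ , M} {_ , N} (inj₂ _) (inj₁ J) = ≅-sym {M = N} {M} J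
≼-antisym (inj₂ l) (inj₂ l′) = ⊥-elim (<ₖ-irrefl _ (<ₖ-trans l l′))

star⇒≼ : ∀ {R : Map → Map → Set} → (∀ {X Y} → R X Y → key Y <ₖ key X) → ∀ {X Y} → Star R X Y → Y ≼ X
star⇒≼ dec {_ , M} ε = inj₁ (≅-refl {M = M})
star⇒≼ dec (s ◅ p)   = ≼-trans (star⇒≼ dec p) (inj₂ (dec s))

glue-decreases : ∀ {X Y} → GlueStep X Y → key Y <ₖ key X
glue-decreases (vglue M N a b _ a≁b _ iso≡ _ α₁-glued α₂-glued) =
  inj₂ (refl , inj₂ (iso≡ , vertexGluing-vertexPairs M N a b a≁b α₁-glued α₂-glued))
glue-decreases (isoglue M N iso≡ _ _ _ _) = inj₂ (refl , inj₁ (subst (iso N <_) (sym iso≡) (n<1+n _)))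
glue-decreases (dupglue M N e f _ _ D)   = inj₁ (deletion-< D)

deletion-decreases : ∀ {X Y} → DelStep X Y → key Y <ₖ key X
deletion-decreases (_ , D) = inj₁ (deletion-< D)

removeIsolated-≼ : ∀ {X Y} → RemoveIsolated X Y → Y ≼ X
removeIsolated-≼ (remove _ _ e₀ e₁ e₂ iso≤) with m≤n⇒m<n∨m≡n iso≤
... | inj₁ iso< = inj₂ (inj₂ (refl , inj₁ iso<))
... | inj₂ iso≡ = inj₁ (≅-pointwise iso≡ e₀ e₁ e₂)

epi⇒≼ : ∀ {M N} → Epi M N → N ≼ M
epi⇒≼ (_ , S , glues , N≅S) = ≼-trans (inj₁ N≅S) (star⇒≼ glue-decreases glues)

mono⇒≼ : ∀ {M N} → Mono M N → M ≼ N
mono⇒≼ (S , (Q , deletions , removal) , M≅S) =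
  ≼-trans (inj₁ M≅S) (≼-trans (removeIsolated-≼ removal) (star⇒≼ deletion-decreases deletions))

proposition3p16 : (M M' : Map) →
    ((Epi M M' × Epi M' M) → M ≅ M') × ((Mono M M' × Mono M' M) → M ≅ M')
proposition3p16 M M' =
  (λ (e , e′) → ≼-antisym (epi⇒≼ e′) (epi⇒≼ e)) , (λ (m , m′) → ≼-antisym (mono⇒≼ m) (mono⇒≼ m′))
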